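{- Let $w$ be a Dyck path and write $L(w)=x^pP(y)$ with $P$ a polynomial in $y$ not divisible by $x$. Then $p$ is the number of factors $ab$ in $w$, and for each $i\ge0$ the coefficient of $y^i$ in $P(y)$ is the number of labelings of $w$ in which exactly $i$ occurrences of $b$ are labeled $b_1$.
   Context: A Dyck path is a word over $\{a,b\}$ with equally many $a$'s and $b$'s such that every prefix has at least as many $a$'s as $b$'s. For a word $g$, $|g|_a,|g|_b$ denote its numbers of $a$'s and $b$'s. The polynomial $L(w)\in\mathbb Z[x,y]$ is the product, over all occurrences of $b$ in $w$ (writing $w=w'bw''$ for each such occurrence), of the factor $x$ if $w'$ ends with $a$, and of the factor $y+h$ with $h=|w'b|_a-|w'b|_b$ otherwise. A labeling of $w$ is a word $f$ over $\{a,b_0,b_1,\dots\}$ obtained by replacing each occurrence of $b$ by some $b_i$ ($i\ge0$) such that: an occurrence $b_i$ is immediately preceded by $a$ if and only if $i=0$; and for every factorization $f=g\,b_i\,h$ with $i>0$, $i\le|g|_a-|g|_b$ (here $|g|_b$ counts all letters $b_j$). -}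

module Defs where

open import Data.Nat using (ℕ; zero; suc; _∸_)
open import Data.Integer using (ℤ; +_; _-_; _≤_) renaming (_+_ to _+ℤ_; _*_ to _*ℤ_)
open import Data.List using (List; []; _∷_; _++_; [_]; last; length)
open import Data.Maybe using (Maybe; just; nothing)
open import Data.Product using (_×_; _,_; ∃)
open import Relation.Binary.PropositionalEquality using (_≡_)
open import Function.Bundles using (_⇔_)
open import Relation.Nullary using (¬_)
open import Data.List.Membership.Propositional using (_∈_)
open import Data.List.Relation.Unary.Unique.Propositional using (Unique)

data AB : Set where
  a b : AB

#a : List AB → ℕ
#a []       = 0
#a (a ∷ g) = suc (#a g)
#a (b ∷ g) = #a g

#b : List AB → ℕ
#b []       = 0
#b (a ∷ g) = #b g
#b (b ∷ g) = suc (#b g)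

Dyck : List AB → Set
Dyck w = (#a w ≡ #b w) × (∀ g h → w ≡ g ++ h → #b g Data.Nat.≤ #a g)

#ab : List AB → ℕ
#ab []           = 0
#ab (a ∷ [])     = 0
#ab (a ∷ a ∷ t)  = #ab (a ∷ t)
#ab (a ∷ b ∷ t)  = suc (#ab (b ∷ t))
#ab (b ∷ t)      = #ab t

splits : {A : Set} → List A → List (List A × A × List A)
splits []       = []
splits (x ∷ xs) = ([] , x , xs) ∷ Data.List.map (λ { (g , y , h) → (x ∷ g , y , h) }) (splits xs)

-- Z[x,y] represented by coefficient functions:  F i j = coefficient of x^i y^j

Ser2 : Set
Ser2 = ℕ → ℕ → ℤ

_≈_ : Ser2 → Ser2 → Set
F ≈ G = ∀ i j → F i j ≡ G i j

sumTo : ℕ → (ℕ → ℤ) → ℤ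
sumTo zero    f = f 0
sumTo (suc n) f = sumTo n f +ℤ f (suc n)

_⊛_ : Ser2 → Ser2 → Ser2
(F ⊛ G) i j = sumTo i (λ k → sumTo j (λ l → F k l *ℤ G (i ∸ k) (j ∸ l)))

_⊕_ : Ser2 → Ser2 → Ser2
(F ⊕ G) i j = F i j +ℤ G i j

one : Ser2
one zero zero = + 1
one _    _    = + 0

const : ℤ → Ser2
const c zero zero = c
const c _    _    = + 0

X : Ser2
X (suc zero) zero = + 1
X _          _    = + 0

Y : Ser2
Y zero (suc zero) = + 1
Y _    _          = + 0

X^ : ℕ → Ser2
X^ zero    = one
X^ (suc p) = X ⊛ X^ p

prod : List Ser2 → Ser2
prod []       = one
prod (F ∷ Fs) = F ⊛ prod Fs

coeff : List ℤ → ℕ → ℤ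
coeff []       _       = + 0
coeff (c ∷ cs) zero    = c
coeff (c ∷ cs) (suc n) = coeff cs n

coeffs : List (List ℤ) → ℕ → List ℤ
coeffs []       _       = []
coeffs (c ∷ cs) zero    = c
coeffs (c ∷ cs) (suc n) = coeffs cs n

-- P(y) ∈ Z[y] ⊆ Z[x,y], P = Σ_j (coeff P j) y^j
⟦_⟧y : List ℤ → Ser2
⟦ P ⟧y zero    j = coeff P j
⟦ P ⟧y (suc i) j = + 0

-- Q ∈ Z[x,y], Q = Σ_{i,j} (coeff (coeffs Q i) j) x^i y^j
⟦_⟧xy : List (List ℤ) → Ser2
⟦ Q ⟧xy i j = coeff (coeffs Q i) j

_∣₂_ : Ser2 → Ser2 → Set
G ∣₂ F = ∃ λ (Q : List (List ℤ)) → F ≈ (G ⊛ ⟦ Q ⟧xy)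

-- factor for an occurrence w = w' b w''
factor : List AB → Ser2
factor w' with last w'
... | just a = X
... | _      = Y ⊕ const ((+ #a (w' ++ [ b ])) - (+ #b (w' ++ [ b ])))

factors : List (List AB × AB × List AB) → List Ser2
factors []                  = []
factors ((w' , a , _) ∷ ss) = factors ss
factors ((w' , b , _) ∷ ss) = factor w' ∷ factors ss

L : List AB → Ser2
L w = prod (factors (splits w))

data Lab : Set where
  la : Lab
  lb : ℕ → Lab

erase : List Lab → List AB
erase []         = []
erase (la ∷ f)   = a ∷ erase f
erase (lb _ ∷ f) = b ∷ erase f

#la : List Lab → ℕ
#la g = #a (erase g)

#lb : List Lab → ℕ
#lb g = #b (erase g)

#b₁ : List Lab → ℕ
#b₁ []                  = 0
#b₁ (la ∷ f)            = #b₁ f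
#b₁ (lb zero ∷ f)       = #b₁ f
#b₁ (lb (suc zero) ∷ f) = suc (#b₁ f)
#b₁ (lb (suc (suc _)) ∷ f) = #b₁ f

IsLabeling : List AB → List Lab → Set
IsLabeling w f =
  (erase f ≡ w)
  × (∀ g i h → f ≡ g ++ lb i ∷ h → (i ≡ 0) ⇔ (last g ≡ just la))
  × (∀ g i h → f ≡ g ++ lb (suc i) ∷ h → + (suc i) ≤ (+ #la g) - (+ #lb g))

-- "the number of labelings of w with exactly i letters b_1 is n":
-- a duplicate-free list enumerating exactly these labelings has length n
NumLabelings : List AB → ℕ → ℕ → Set
NumLabelings w i n =
  ∃ λ (fs : List (List Lab)) →
    Unique fs
    × (∀ f → (f ∈ fs) ⇔ (IsLabeling w f × #b₁ f ≡ i))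
    × length fs ≡ n

module Submission where

-- Read w from left to right, keeping the current height H and whether the previous letter is a.
-- A b right after an a contributes the factor x to L(w) and admits only the label b₀; any other b,
-- going down from height H + 1 to H, contributes y + H and admits the label b₁ (marked by y) or
-- one of the H labels b₂, …, b_{H+1}. So L(w) and x^{#ab w} Σ_f y^{#b₁ f}, summed over the
-- labelings f of w, obey the same recursion and are equal. This polynomial in y is nonzero, as
-- every Dyck path has a labeling, so comparing it with x^p P(y), where x ∤ P, gives the claim.

open import Defs
open import Data.Nat using (ℕ; zero; suc; _∸_; _≤_; _<_; z≤n; s≤s; s≤s⁻¹; _≟_) renaming (_+_ to _+ℕ_; _*_ to _*ℕ_)
open import Data.Integer using (ℤ; +_; _-_; _⊖_; +≤+) renaming (_+_ to _+ℤ_; _*_ to _*ℤ_; _≤_ to _≤ℤ_)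
import Data.Nat.Properties as ℕP
import Data.Integer.Properties as ℤP
open import Data.List using (List; []; _∷_; _++_; [_]; last; length; map)
open import Data.List.Properties using (++-assoc; ++-identityʳ; map-cong; map-∘; map-id; length-map; length-++; ∷-injectiveˡ; ∷-injectiveʳ)
open import Data.Maybe using (Maybe; just; nothing)
open import Data.Bool using (Bool; true; false)
open import Data.Product using (_×_; _,_; ∃; proj₁; proj₂)
open import Data.Empty using (⊥-elim)
open import Data.Unit using (⊤; tt)
open import Data.Sum using (inj₁; inj₂)
open import Data.List.Membership.Propositional using (_∈_)
open import Data.List.Membership.Propositional.Properties using (∈-map⁺; ∈-map⁻; ∈-++⁺ˡ; ∈-++⁺ʳ; ∈-++⁻)
open import Data.List.Relation.Unary.Any using (here; there)
open import Data.List.Relation.Unary.AllPairs using ([]; _∷_)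
import Data.List.Relation.Unary.All as All
open import Data.List.Relation.Unary.Unique.Propositional using (Unique)
import Data.List.Relation.Unary.Unique.Propositional.Properties as Uniqueₚ
open import Function using (_∘_)
open import Function.Bundles using (_⇔_; mk⇔; Equivalence)
open import Relation.Binary.Bundles using (Setoid)
open import Relation.Binary.Definitions using (tri<; tri≈; tri>)
open import Relation.Binary.PropositionalEquality hiding ([_])
open import Relation.Nullary using (¬_; yes; no)
import Relation.Binary.Reasoning.Setoid as SetoidReasoning

sumTo-cong : ∀ n {f g : ℕ → ℤ} → (∀ k → f k ≡ g k) → sumTo n f ≡ sumTo n g
sumTo-cong zero    e = e 0
sumTo-cong (suc n) e = cong₂ _+ℤ_ (sumTo-cong n e) (e (suc n))

sumTo-sucˡ : ∀ n (f : ℕ → ℤ) → sumTo (suc n) f ≡ f 0 +ℤ sumTo n (λ k → f (suc k))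
sumTo-sucˡ zero    f = refl
sumTo-sucˡ (suc n) f rewrite sumTo-sucˡ n f = ℤP.+-assoc (f 0) _ _

sumTo-supported-at-0 : ∀ n (f : ℕ → ℤ) → (∀ k → f (suc k) ≡ + 0) → sumTo n f ≡ f 0
sumTo-supported-at-0 zero    f e = refl
sumTo-supported-at-0 (suc n) f e rewrite sumTo-supported-at-0 n f e | e n = ℤP.+-identityʳ (f 0)

sumTo-zeros : ∀ n (f : ℕ → ℤ) → (∀ k → f k ≡ + 0) → sumTo n f ≡ + 0
sumTo-zeros n f e = trans (sumTo-supported-at-0 n f (λ k → e (suc k))) (e 0)

ser2-setoid : Setoid _ _
ser2-setoid = record
  { Carrier       = Ser2
  ; _≈_           = _≈_
  ; isEquivalence = record
    { refl  = λ i j → refl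
    ; sym   = λ e i j → sym (e i j)
    ; trans = λ e e′ i j → trans (e i j) (e′ i j)
    }
  }

open Setoid ser2-setoid using () renaming (refl to ≈-refl; sym to ≈-sym; trans to ≈-trans)
module ≈-Reasoning = SetoidReasoning ser2-setoid

⊛-congˡ : ∀ {F G} H → F ≈ G → (F ⊛ H) ≈ (G ⊛ H)
⊛-congˡ H e i j = sumTo-cong i λ k → sumTo-cong j λ l → cong (_*ℤ H (i ∸ k) (j ∸ l)) (e k l)

⊛-congʳ : ∀ F {G H} → G ≈ H → (F ⊛ G) ≈ (F ⊛ H)
⊛-congʳ F e i j = sumTo-cong i λ k → sumTo-cong j λ l → cong (F k l *ℤ_) (e (i ∸ k) (j ∸ l))

⊛-identityˡ : ∀ G → (one ⊛ G) ≈ G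
⊛-identityˡ G i j =
  trans (sumTo-supported-at-0 i _ λ k → sumTo-zeros j _ λ l → refl)
        (trans (sumTo-supported-at-0 j _ λ l → refl) (ℤP.*-identityˡ (G i j)))

shiftX1 : Ser2 → Ser2
shiftX1 G zero    j = + 0
shiftX1 G (suc i) j = G i j

shiftX : ℕ → Ser2 → Ser2
shiftX zero    G = G
shiftX (suc n) G = shiftX1 (shiftX n G)

shiftX1-cong : ∀ {F G} → F ≈ G → shiftX1 F ≈ shiftX1 G
shiftX1-cong e zero    j = refl
shiftX1-cong e (suc i) j = e i j

shiftX-cong : ∀ n {F G} → F ≈ G → shiftX n F ≈ shiftX n G
shiftX-cong zero    e = e
shiftX-cong (suc n) e = shiftX1-cong (shiftX-cong n e)

shiftX-at : ∀ n G j → shiftX n G n j ≡ G 0 j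
shiftX-at zero    G j = refl
shiftX-at (suc n) G j = shiftX-at n G j

shiftX-below : ∀ {n i} G j → i < n → shiftX n G i j ≡ + 0
shiftX-below {suc n} {zero}  G j _         = refl
shiftX-below {suc n} {suc i} G j (s≤s i<n) = shiftX-below G j i<n

shiftX1-⊛ : ∀ F G → (shiftX1 F ⊛ G) ≈ shiftX1 (F ⊛ G)
shiftX1-⊛ F G zero    j = sumTo-zeros j _ λ l → refl
shiftX1-⊛ F G (suc i) j =
  trans (sumTo-sucˡ i _)
        (trans (cong (_+ℤ (F ⊛ G) i j) (sumTo-zeros j _ λ l → refl)) (ℤP.+-identityˡ _))

shiftX-⊛ : ∀ n F G → (shiftX n F ⊛ G) ≈ shiftX n (F ⊛ G)
shiftX-⊛ zero    F G = ≈-refl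
shiftX-⊛ (suc n) F G = ≈-trans (shiftX1-⊛ (shiftX n F) G) (shiftX1-cong (shiftX-⊛ n F G))

X≈shiftX1-one : X ≈ shiftX1 one
X≈shiftX1-one zero                zero    = refl
X≈shiftX1-one zero                (suc j) = refl
X≈shiftX1-one (suc zero)          zero    = refl
X≈shiftX1-one (suc zero)          (suc j) = refl
X≈shiftX1-one (suc (suc i))       j       = refl

X⊛≈shiftX1 : ∀ G → (X ⊛ G) ≈ shiftX1 G
X⊛≈shiftX1 G = begin
  X ⊛ G               ≈⟨ ⊛-congˡ G X≈shiftX1-one ⟩
  shiftX1 one ⊛ G     ≈⟨ shiftX1-⊛ one G ⟩
  shiftX1 (one ⊛ G)   ≈⟨ shiftX1-cong (⊛-identityˡ G) ⟩
  shiftX1 G           ∎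
  where open ≈-Reasoning

X^⊛≈shiftX : ∀ p G → (X^ p ⊛ G) ≈ shiftX p G
X^⊛≈shiftX p G = begin
  X^ p ⊛ G             ≈⟨ ⊛-congˡ G (X^≈shiftX p) ⟩
  shiftX p one ⊛ G     ≈⟨ shiftX-⊛ p one G ⟩
  shiftX p (one ⊛ G)   ≈⟨ shiftX-cong p (⊛-identityˡ G) ⟩
  shiftX p G           ∎
  where
  open ≈-Reasoning
  X^≈shiftX : ∀ p → X^ p ≈ shiftX p one
  X^≈shiftX zero    = λ i j → refl
  X^≈shiftX (suc p) i j =
    trans (⊛-congʳ X (X^≈shiftX p) i j) (X⊛≈shiftX1 (shiftX p one) i j)

Y+c⊛-coeff₀ : ∀ c G i → ((Y ⊕ const c) ⊛ G) i 0 ≡ c *ℤ G i 0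
Y+c⊛-coeff₀ c G i =
  trans (sumTo-supported-at-0 i _ λ k → refl) (cong (_*ℤ G i 0) (ℤP.+-identityˡ c))

Y+c⊛-coeffₛ : ∀ c G i j → ((Y ⊕ const c) ⊛ G) i (suc j) ≡ G i j +ℤ c *ℤ G i (suc j)
Y+c⊛-coeffₛ c G i j = begin
    sumTo i (λ k → sumTo (suc j) (λ l → (Y ⊕ const c) k l *ℤ G (i ∸ k) (suc j ∸ l)))
  ≡⟨ sumTo-supported-at-0 i _ (λ k → sumTo-zeros (suc j) _ λ l → refl) ⟩
    sumTo (suc j) (λ l → (Y 0 l +ℤ const c 0 l) *ℤ G i (suc j ∸ l))
  ≡⟨ sumTo-sucˡ j _ ⟩
    (+ 0 +ℤ c) *ℤ G i (suc j) +ℤ sumTo j (λ l → (Y 0 (suc l) +ℤ + 0) *ℤ G i (j ∸ l))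
  ≡⟨ cong₂ _+ℤ_ (cong (_*ℤ G i (suc j)) (ℤP.+-identityˡ c)) (sumTo-supported-at-0 j _ λ l → refl) ⟩
    c *ℤ G i (suc j) +ℤ (+ 1 +ℤ + 0) *ℤ G i j
  ≡⟨ cong (c *ℤ G i (suc j) +ℤ_) (ℤP.*-identityˡ (G i j)) ⟩
    c *ℤ G i (suc j) +ℤ G i j
  ≡⟨ ℤP.+-comm (c *ℤ G i (suc j)) (G i j) ⟩
    G i j +ℤ c *ℤ G i (suc j) ∎
  where open ≡-Reasoning

Y+c⊛-shiftX1 : ∀ c G → ((Y ⊕ const c) ⊛ shiftX1 G) ≈ shiftX1 ((Y ⊕ const c) ⊛ G)
Y+c⊛-shiftX1 c G zero zero = trans (Y+c⊛-coeff₀ c (shiftX1 G) 0) (ℤP.*-zeroʳ c)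
Y+c⊛-shiftX1 c G zero (suc j) =
  trans (Y+c⊛-coeffₛ c (shiftX1 G) 0 j) (trans (ℤP.+-identityˡ _) (ℤP.*-zeroʳ c))
Y+c⊛-shiftX1 c G (suc i) zero = trans (Y+c⊛-coeff₀ c (shiftX1 G) (suc i)) (sym (Y+c⊛-coeff₀ c G i))
Y+c⊛-shiftX1 c G (suc i) (suc j) =
  trans (Y+c⊛-coeffₛ c (shiftX1 G) (suc i) j) (sym (Y+c⊛-coeffₛ c G i j))

Y+c⊛-shiftX : ∀ c n G → ((Y ⊕ const c) ⊛ shiftX n G) ≈ shiftX n ((Y ⊕ const c) ⊛ G)
Y+c⊛-shiftX c zero    G = ≈-refl
Y+c⊛-shiftX c (suc n) G = ≈-trans (Y+c⊛-shiftX1 c (shiftX n G)) (shiftX1-cong (Y+c⊛-shiftX c n G))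

yPoly : (ℕ → ℕ) → Ser2
yPoly q zero    j = + q j
yPoly q (suc i) j = + 0

yPoly-cong : ∀ {q q′} → (∀ k → q k ≡ q′ k) → yPoly q ≈ yPoly q′
yPoly-cong e zero    j = cong +_ (e j)
yPoly-cong e (suc i) j = refl

mulY+ : ℕ → (ℕ → ℕ) → ℕ → ℕ
mulY+ h q zero    = h *ℕ q 0
mulY+ h q (suc k) = q k +ℕ h *ℕ q (suc k)

Y+h⊛yPoly : ∀ h q → ((Y ⊕ const (+ h)) ⊛ yPoly q) ≈ yPoly (mulY+ h q)
Y+h⊛yPoly h q zero zero = trans (Y+c⊛-coeff₀ (+ h) (yPoly q) 0) (sym (ℤP.pos-* h (q 0)))
Y+h⊛yPoly h q zero (suc j) =
  trans (Y+c⊛-coeffₛ (+ h) (yPoly q) 0 j)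
        (trans (cong (+ q j +ℤ_) (sym (ℤP.pos-* h (q (suc j))))) (sym (ℤP.pos-+ (q j) _)))
Y+h⊛yPoly h q (suc i) zero = trans (Y+c⊛-coeff₀ (+ h) (yPoly q) (suc i)) (ℤP.*-zeroʳ (+ h))
Y+h⊛yPoly h q (suc i) (suc j) =
  trans (Y+c⊛-coeffₛ (+ h) (yPoly q) (suc i) j) (trans (ℤP.+-identityˡ _) (ℤP.*-zeroʳ (+ h)))

X∣₂-zero : ∀ P → (∀ j → coeff P j ≡ + 0) → X ∣₂ ⟦ P ⟧y
X∣₂-zero P zeros = [] , P≈X⊛0
  where
  P≈X⊛0 : ⟦ P ⟧y ≈ (X ⊛ ⟦ [] ⟧xy)
  P≈X⊛0 zero    j = trans (zeros j) (sym (X⊛≈shiftX1 ⟦ [] ⟧xy zero j))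
  P≈X⊛0 (suc i) j = sym (X⊛≈shiftX1 ⟦ [] ⟧xy (suc i) j)

shiftX-yPoly-unique : ∀ {n p q} P k → q k ≢ 0 → ¬ (X ∣₂ ⟦ P ⟧y) →
  shiftX n (yPoly q) ≈ shiftX p ⟦ P ⟧y → n ≡ p × (∀ j → coeff P j ≡ + q j)
shiftX-yPoly-unique {n} {p} {q} P k qk≢0 X∤P eq with ℕP.<-cmp n p
... | tri< n<p _ _ = ⊥-elim (qk≢0 (ℤP.+-injective (begin
  + q k                  ≡⟨ shiftX-at n (yPoly q) k ⟨
  shiftX n (yPoly q) n k ≡⟨ eq n k ⟩
  shiftX p ⟦ P ⟧y n k    ≡⟨ shiftX-below ⟦ P ⟧y k n<p ⟩
  + 0                    ∎)))
  where open ≡-Reasoning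
... | tri> _ _ p<n = ⊥-elim (X∤P (X∣₂-zero P λ j → begin
  coeff P j              ≡⟨ shiftX-at p ⟦ P ⟧y j ⟨
  shiftX p ⟦ P ⟧y p j    ≡⟨ eq p j ⟨
  shiftX n (yPoly q) p j ≡⟨ shiftX-below (yPoly q) j p<n ⟩
  + 0                    ∎))
  where open ≡-Reasoning
... | tri≈ _ refl _ = refl , λ j →
  trans (sym (shiftX-at n ⟦ P ⟧y j)) (trans (sym (eq n j)) (shiftX-at n (yPoly q) j))

#a-++ : ∀ g h → #a (g ++ h) ≡ #a g +ℕ #a h
#a-++ []      h = refl
#a-++ (a ∷ g) h = cong suc (#a-++ g h)
#a-++ (b ∷ g) h = #a-++ g h

#b-++ : ∀ g h → #b (g ++ h) ≡ #b g +ℕ #b h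
#b-++ []      h = refl
#b-++ (a ∷ g) h = #b-++ g h
#b-++ (b ∷ g) h = cong suc (#b-++ g h)

height-snoc-a : ∀ {H} g → #a g ≡ H +ℕ #b g → #a (g ++ [ a ]) ≡ suc H +ℕ #b (g ++ [ a ])
height-snoc-a {H} g ht rewrite #a-++ g [ a ] | #b-++ g [ a ] | ht =
  trans (ℕP.+-comm _ 1) (cong (suc ∘ (H +ℕ_)) (sym (ℕP.+-identityʳ (#b g))))

height-snoc-b : ∀ {H} g → #a g ≡ suc H +ℕ #b g → #a (g ++ [ b ]) ≡ H +ℕ #b (g ++ [ b ])
height-snoc-b {H} g ht rewrite #a-++ g [ b ] | #b-++ g [ b ] | ht =
  trans (ℕP.+-identityʳ _) (trans (sym (ℕP.+-suc H (#b g))) (cong (H +ℕ_) (ℕP.+-comm 1 (#b g))))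

+[m+n]-+n≡+m : ∀ m n → + (m +ℕ n) - + n ≡ + m
+[m+n]-+n≡+m m n = begin
  + (m +ℕ n) - + n   ≡⟨ ℤP.m-n≡m⊖n (m +ℕ n) n ⟩
  (m +ℕ n) ⊖ n       ≡⟨ ℤP.⊖-≥ (ℕP.m≤n+m n m) ⟩
  + (m +ℕ n ∸ n)     ≡⟨ cong +_ (ℕP.m+n∸n≡m m n) ⟩
  + m                ∎
  where open ≡-Reasoning

last-snoc : ∀ {A : Set} (g : List A) x → last (g ++ [ x ]) ≡ just x
last-snoc []          x = refl
last-snoc (y ∷ [])    x = refl
last-snoc (y ∷ z ∷ g) x = last-snoc (z ∷ g) x

HeightBounded : ℕ → List AB → Set
HeightBounded H w = ∀ u v → w ≡ u ++ v → #b u ≤ H +ℕ #a u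

HeightBounded-a : ∀ {H w} → HeightBounded H (a ∷ w) → HeightBounded (suc H) w
HeightBounded-a {H} hb u v e =
  subst (#b u ≤_) (ℕP.+-suc H (#a u)) (hb (a ∷ u) v (cong (a ∷_) e))

HeightBounded-b : ∀ {H w} → HeightBounded (suc H) (b ∷ w) → HeightBounded H w
HeightBounded-b hb u v e = s≤s⁻¹ (hb (b ∷ u) v (cong (b ∷_) e))

¬HeightBounded-0-b : ∀ {w} → ¬ HeightBounded 0 (b ∷ w)
¬HeightBounded-0-b {w} hb with hb [ b ] w refl
... | ()

Dyck⇒HeightBounded : ∀ {w} → Dyck w → HeightBounded 0 w
Dyck⇒HeightBounded (_ , prefixes) = prefixes

isA : Maybe AB → Bool
isA (just a) = true
isA _        = false

factor-after-a : ∀ g → isA (last g) ≡ true → factor g ≡ X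
factor-after-a g e with last g | e
... | just a | _ = refl

factor-after-non-a : ∀ g → isA (last g) ≡ false →
  factor g ≡ Y ⊕ const (+ #a (g ++ [ b ]) - + #b (g ++ [ b ]))
factor-after-non-a g e with last g | e
... | just b  | _ = refl
... | nothing | _ = refl

factor-after-b : ∀ {H} g → isA (last g) ≡ false → #a g ≡ suc H +ℕ #b g → factor g ≡ Y ⊕ const (+ H)
factor-after-b {H} g e ht = trans (factor-after-non-a g e) (cong (Y ⊕_ ∘ const) height)
  where
  height : + #a (g ++ [ b ]) - + #b (g ++ [ b ]) ≡ + H
  height = trans (cong (λ m → + m - + #b (g ++ [ b ])) (height-snoc-b g ht))
                 (+[m+n]-+n≡+m H (#b (g ++ [ b ])))

consLabels : ℕ → ℕ → List (List Lab) → List (List Lab)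
consLabels zero    s fs = []
consLabels (suc n) s fs = map (lb s ∷_) fs ++ consLabels n (suc s) fs

-- The labeled words with exactly k letters b₁ that erase to w and can follow a labeled prefix of
-- height H ending in a iff t.
labelings : ℕ → Bool → ℕ → List AB → List (List Lab)
labelings H       t     k       (a ∷ w) = map (la ∷_) (labelings (suc H) true k w)
labelings H       t     zero    []      = [] ∷ []
labelings H       t     (suc k) []      = []
labelings zero    t     k       (b ∷ w) = []
labelings (suc H) true  k       (b ∷ w) = map (lb 0 ∷_) (labelings H false k w)
labelings (suc H) false zero    (b ∷ w) = consLabels H 2 (labelings H false zero w)
labelings (suc H) false (suc k) (b ∷ w) =
  map (lb 1 ∷_) (labelings H false k w) ++ consLabels H 2 (labelings H false (suc k) w)

#labelings : ℕ → Bool → List AB → ℕ → ℕ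
#labelings H t w k = length (labelings H t k w)

length-consLabels : ∀ n s fs → length (consLabels n s fs) ≡ n *ℕ length fs
length-consLabels zero    s fs = refl
length-consLabels (suc n) s fs =
  trans (length-++ (map (lb s ∷_) fs))
        (cong₂ _+ℕ_ (length-map _ fs) (length-consLabels n (suc s) fs))

length-labelings-b∷ : ∀ H w k →
  #labelings (suc H) false (b ∷ w) k ≡ mulY+ H (#labelings H false w) k
length-labelings-b∷ H w zero    = length-consLabels H 2 _
length-labelings-b∷ H w (suc k) =
  trans (length-++ (map (lb 1 ∷_) (labelings H false k w)))
        (cong₂ _+ℕ_ (length-map (lb 1 ∷_) (labelings H false k w)) (length-consLabels H 2 _))

prependTo : List AB → List AB × AB × List AB → List AB × AB × List AB
prependTo g (g′ , x , h) = g ++ g′ , x , h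

-- The part of L contributed by the b's of w, when w is preceded by g.
L-after : List AB → List AB → Ser2
L-after g w = prod (factors (map (prependTo g) (splits w)))

L≡L-after-[] : ∀ w → L w ≡ L-after [] w
L≡L-after-[] w =
  cong (prod ∘ factors) (sym (trans (map-cong (λ _ → refl) (splits w)) (map-id (splits w))))

splits-∷ : ∀ g x w →
  map (prependTo g) (splits (x ∷ w)) ≡ (g ++ [] , x , w) ∷ map (prependTo (g ++ [ x ])) (splits w)
splits-∷ g x w = cong ((g ++ [] , x , w) ∷_) (trans (sym (map-∘ (splits w)))
  (map-cong (λ { (g′ , y , h) → cong (λ z → z , y , h) (sym (++-assoc g [ x ] g′)) }) (splits w)))

L-after-a∷ : ∀ g w → L-after g (a ∷ w) ≡ L-after (g ++ [ a ]) w
L-after-a∷ g w = cong (prod ∘ factors) (splits-∷ g a w)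

L-after-b∷ : ∀ g w → L-after g (b ∷ w) ≡ factor g ⊛ L-after (g ++ [ b ]) w
L-after-b∷ g w = trans (cong (prod ∘ factors) (splits-∷ g b w))
                       (cong (λ g′ → factor g′ ⊛ L-after (g ++ [ b ]) w) (++-identityʳ g))

#abAfter : Bool → List AB → ℕ
#abAfter true  w = #ab (a ∷ w)
#abAfter false w = #ab w

#abAfter-a∷ : ∀ t w → #abAfter t (a ∷ w) ≡ #abAfter true w
#abAfter-a∷ true  w = refl
#abAfter-a∷ false w = refl

one≈yPoly-labelings-[] : ∀ {H t} → one ≈ yPoly (#labelings H t [])
one≈yPoly-labelings-[] zero    zero    = refl
one≈yPoly-labelings-[] zero    (suc j) = refl
one≈yPoly-labelings-[] (suc i) j       = refl

L-after≈shiftX : ∀ w {H t g} → #a g ≡ H +ℕ #b g → isA (last g) ≡ t → HeightBounded H w →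
  L-after g w ≈ shiftX (#abAfter t w) (yPoly (#labelings H t w))
L-after≈shiftX [] {t = true}  ht lst hb = one≈yPoly-labelings-[]
L-after≈shiftX [] {t = false} ht lst hb = one≈yPoly-labelings-[]
L-after≈shiftX (a ∷ w) {H} {t} {g} ht lst hb = begin
  L-after g (a ∷ w)
    ≡⟨ L-after-a∷ g w ⟩
  L-after (g ++ [ a ]) w
    ≈⟨ L-after≈shiftX w (height-snoc-a g ht) (cong isA (last-snoc g a)) (HeightBounded-a hb) ⟩
  shiftX (#abAfter true w) (yPoly (#labelings (suc H) true w))
    ≈⟨ shiftX-cong (#abAfter true w)
         (yPoly-cong λ k → sym (length-map (la ∷_) (labelings (suc H) true k w))) ⟩
  shiftX (#abAfter true w) (yPoly (#labelings H t (a ∷ w)))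
    ≡⟨ cong (λ n → shiftX n (yPoly (#labelings H t (a ∷ w)))) (sym (#abAfter-a∷ t w)) ⟩
  shiftX (#abAfter t (a ∷ w)) (yPoly (#labelings H t (a ∷ w))) ∎
  where open ≈-Reasoning
L-after≈shiftX (b ∷ w) {zero} ht lst hb = ⊥-elim (¬HeightBounded-0-b hb)
L-after≈shiftX (b ∷ w) {suc H} {true} {g} ht lst hb = begin
  L-after g (b ∷ w)
    ≡⟨ L-after-b∷ g w ⟩
  factor g ⊛ L-after (g ++ [ b ]) w
    ≡⟨ cong (_⊛ L-after (g ++ [ b ]) w) (factor-after-a g lst) ⟩
  X ⊛ L-after (g ++ [ b ]) w
    ≈⟨ ⊛-congʳ X (L-after≈shiftX w (height-snoc-b g ht) (cong isA (last-snoc g b)) (HeightBounded-b hb)) ⟩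
  X ⊛ shiftX (#ab w) (yPoly q)
    ≈⟨ X⊛≈shiftX1 _ ⟩
  shiftX (suc (#ab w)) (yPoly q)
    ≈⟨ shiftX-cong (suc (#ab w))
         (yPoly-cong λ k → sym (length-map (lb 0 ∷_) (labelings H false k w))) ⟩
  shiftX (#abAfter true (b ∷ w)) (yPoly (#labelings (suc H) true (b ∷ w))) ∎
  where
  open ≈-Reasoning
  q : ℕ → ℕ
  q = #labelings H false w
L-after≈shiftX (b ∷ w) {suc H} {false} {g} ht lst hb = begin
  L-after g (b ∷ w)
    ≡⟨ L-after-b∷ g w ⟩
  factor g ⊛ L-after (g ++ [ b ]) w
    ≡⟨ cong (_⊛ L-after (g ++ [ b ]) w) (factor-after-b g lst ht) ⟩
  (Y ⊕ const (+ H)) ⊛ L-after (g ++ [ b ]) w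
    ≈⟨ ⊛-congʳ (Y ⊕ const (+ H))
         (L-after≈shiftX w (height-snoc-b g ht) (cong isA (last-snoc g b)) (HeightBounded-b hb)) ⟩
  (Y ⊕ const (+ H)) ⊛ shiftX (#ab w) (yPoly q)
    ≈⟨ Y+c⊛-shiftX (+ H) (#ab w) (yPoly q) ⟩
  shiftX (#ab w) ((Y ⊕ const (+ H)) ⊛ yPoly q)
    ≈⟨ shiftX-cong (#ab w) (Y+h⊛yPoly H q) ⟩
  shiftX (#ab w) (yPoly (mulY+ H q))
    ≈⟨ shiftX-cong (#ab w) (yPoly-cong λ k → sym (length-labelings-b∷ H w k)) ⟩
  shiftX (#abAfter false (b ∷ w)) (yPoly (#labelings (suc H) false (b ∷ w))) ∎
  where
  open ≈-Reasoning
  q : ℕ → ℕ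
  q = #labelings H false w

-- A labeled word read from height H, after an a iff t; a positive label may not exceed the
-- height reached just before its letter, which is suc H for the b's below.
data ValidFrom : ℕ → Bool → List Lab → Set where
  []    : ∀ {H t} → ValidFrom H t []
  la∷   : ∀ {H t f} → ValidFrom (suc H) true f → ValidFrom H t (la ∷ f)
  b₀∷   : ∀ {H f} → ValidFrom H false f → ValidFrom (suc H) true (lb 0 ∷ f)
  b₁∷   : ∀ {H f} → ValidFrom H false f → ValidFrom (suc H) false (lb 1 ∷ f)
  b₂₊∷  : ∀ {H i f} → i < H → ValidFrom H false f → ValidFrom (suc H) false (lb (suc (suc i)) ∷ f)

∈-consLabels⁻ : ∀ n s fs {f} → f ∈ consLabels n s fs →
  ∃ λ i → ∃ λ f′ → s ≤ i × i < s +ℕ n × f ≡ lb i ∷ f′ × f′ ∈ fs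
∈-consLabels⁻ (suc n) s fs m with ∈-++⁻ (map (lb s ∷_) fs) m
... | inj₁ m′ with ∈-map⁻ (lb s ∷_) m′
...   | f′ , f′∈fs , refl = s , f′ , ℕP.≤-refl , ℕP.m<m+n s (s≤s z≤n) , refl , f′∈fs
∈-consLabels⁻ (suc n) s fs m | inj₂ m′ with ∈-consLabels⁻ n (suc s) fs m′
... | i , f′ , s<i , i<s+n , refl , f′∈fs =
  i , f′ , ℕP.<⇒≤ s<i , subst (i <_) (sym (ℕP.+-suc s n)) i<s+n , refl , f′∈fs

∈-consLabels⁺ : ∀ n s fs {i f} → s ≤ i → i < s +ℕ n → f ∈ fs → (lb i ∷ f) ∈ consLabels n s fs
∈-consLabels⁺ zero s fs s≤i i<s+0 m =
  ⊥-elim (ℕP.<⇒≱ i<s+0 (subst (_≤ _) (sym (ℕP.+-identityʳ s)) s≤i))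
∈-consLabels⁺ (suc n) s fs {i} s≤i i<s+n m with s ≟ i
... | yes refl = ∈-++⁺ˡ (∈-map⁺ (lb s ∷_) m)
... | no s≢i   = ∈-++⁺ʳ (map (lb s ∷_) fs)
  (∈-consLabels⁺ n (suc s) fs (ℕP.≤∧≢⇒< s≤i s≢i) (subst (i <_) (ℕP.+-suc s n) i<s+n) m)

consLabels-sound : ∀ {H k w fs f} →
  (∀ {f′} → f′ ∈ fs → ValidFrom H false f′ × erase f′ ≡ w × #b₁ f′ ≡ k) →
  f ∈ consLabels H 2 fs → ValidFrom (suc H) false f × erase f ≡ b ∷ w × #b₁ f ≡ k
consLabels-sound {H} sound m with ∈-consLabels⁻ H 2 _ m
... | suc zero , _ , s≤s () , _
... | suc (suc j) , f , _ , s≤s (s≤s j<H) , refl , f∈ with sound f∈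
...   | v , refl , c = b₂₊∷ j<H v , refl , c

labelings-sound : ∀ {H t k} w {f} → f ∈ labelings H t k w →
  ValidFrom H t f × erase f ≡ w × #b₁ f ≡ k
labelings-sound (a ∷ w) m with ∈-map⁻ (la ∷_) m
... | f , f∈ , refl with labelings-sound w f∈
...   | v , refl , c = la∷ v , refl , c
labelings-sound {k = zero} [] (here refl) = [] , refl , refl
labelings-sound {suc H} {true} (b ∷ w) m with ∈-map⁻ (lb 0 ∷_) m
... | f , f∈ , refl with labelings-sound w f∈
...   | v , refl , c = b₀∷ v , refl , c
labelings-sound {suc H} {false} {zero} (b ∷ w) m = consLabels-sound (labelings-sound w) m
labelings-sound {suc H} {false} {suc k} (b ∷ w) m
  with ∈-++⁻ (map (lb 1 ∷_) (labelings H false k w)) m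
... | inj₂ m′ = consLabels-sound (labelings-sound w) m′
... | inj₁ m′ with ∈-map⁻ (lb 1 ∷_) m′
...   | f , f∈ , refl with labelings-sound w f∈
...     | v , refl , c = b₁∷ v , refl , cong suc c

consLabels⊆labelings : ∀ {H w f} k → f ∈ consLabels H 2 (labelings H false k w) →
  f ∈ labelings (suc H) false k (b ∷ w)
consLabels⊆labelings zero    m = m
consLabels⊆labelings {H} {w} (suc k) m = ∈-++⁺ʳ (map (lb 1 ∷_) (labelings H false k w)) m

labelings-complete : ∀ {H t f} → ValidFrom H t f → f ∈ labelings H t (#b₁ f) (erase f)
labelings-complete []       = here refl
labelings-complete (la∷ v)  = ∈-map⁺ (la ∷_) (labelings-complete v)
labelings-complete (b₀∷ v)  = ∈-map⁺ (lb 0 ∷_) (labelings-complete v)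
labelings-complete (b₁∷ v)  = ∈-++⁺ˡ (∈-map⁺ (lb 1 ∷_) (labelings-complete v))
labelings-complete {suc H} {f = lb _ ∷ f} (b₂₊∷ j<H v) =
  consLabels⊆labelings {H} {erase f} (#b₁ f)
    (∈-consLabels⁺ H 2 _ (s≤s (s≤s z≤n)) (s≤s (s≤s j<H)) (labelings-complete v))

Unique-map-∷ : ∀ x {fs : List (List Lab)} → Unique fs → Unique (map (x ∷_) fs)
Unique-map-∷ x = Uniqueₚ.map⁺ ∷-injectiveʳ

lb-injective : ∀ {i j} → lb i ≡ lb j → i ≡ j
lb-injective refl = refl

Unique-consLabels : ∀ n s {fs} → Unique fs → Unique (consLabels n s fs)
Unique-consLabels zero    s u = []
Unique-consLabels (suc n) s {fs} u =
  Uniqueₚ.++⁺ (Unique-map-∷ (lb s) u) (Unique-consLabels n (suc s) u) disjoint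
  where
  disjoint : ∀ {f} → ¬ (f ∈ map (lb s ∷_) fs × f ∈ consLabels n (suc s) fs)
  disjoint (m₁ , m₂) with ∈-map⁻ (lb s ∷_) m₁ | ∈-consLabels⁻ n (suc s) fs m₂
  ... | _ , _ , refl | _ , _ , s<i , _ , e , _ = ℕP.<⇒≢ s<i (lb-injective (∷-injectiveˡ e))

labelings-unique : ∀ H t k w → Unique (labelings H t k w)
labelings-unique H       t     k       (a ∷ w) = Unique-map-∷ la (labelings-unique (suc H) true k w)
labelings-unique H       t     zero    []      = All.[] ∷ []
labelings-unique H       t     (suc k) []      = []
labelings-unique zero    t     k       (b ∷ w) = []
labelings-unique (suc H) true  k       (b ∷ w) = Unique-map-∷ (lb 0) (labelings-unique H false k w)
labelings-unique (suc H) false zero    (b ∷ w) =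
  Unique-consLabels H 2 (labelings-unique H false zero w)
labelings-unique (suc H) false (suc k) (b ∷ w) =
  Uniqueₚ.++⁺ (Unique-map-∷ (lb 1) (labelings-unique H false k w))
              (Unique-consLabels H 2 (labelings-unique H false (suc k) w)) disjoint
  where
  disjoint : ∀ {f} →
    ¬ (f ∈ map (lb 1 ∷_) (labelings H false k w) × f ∈ consLabels H 2 (labelings H false (suc k) w))
  disjoint (m₁ , m₂) with ∈-map⁻ (lb 1 ∷_) m₁ | ∈-consLabels⁻ H 2 _ m₂
  ... | _ , _ , refl | _ , _ , 1<i , _ , e , _ = ℕP.<⇒≢ 1<i (lb-injective (∷-injectiveˡ e))

validFrom-exists : ∀ w {H} t → HeightBounded H w → ∃ λ f → ValidFrom H t f × erase f ≡ w
validFrom-exists []      t hb = [] , [] , refl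
validFrom-exists (a ∷ w) t hb with validFrom-exists w true (HeightBounded-a hb)
... | f , v , refl = la ∷ f , la∷ v , refl
validFrom-exists (b ∷ w) {zero} t hb = ⊥-elim (¬HeightBounded-0-b hb)
validFrom-exists (b ∷ w) {suc H} true hb with validFrom-exists w false (HeightBounded-b hb)
... | f , v , refl = lb 0 ∷ f , b₀∷ v , refl
validFrom-exists (b ∷ w) {suc H} false hb with validFrom-exists w false (HeightBounded-b hb)
... | f , v , refl = lb 1 ∷ f , b₁∷ v , refl

isLa : Maybe Lab → Bool
isLa (just la) = true
isLa _         = false

isLa-true : ∀ {m} → isLa m ≡ true → m ≡ just la
isLa-true {just la} _ = refl

isLa-false : ∀ {m} → isLa m ≡ false → m ≢ just la
isLa-false () refl

erase-++ : ∀ g h → erase (g ++ h) ≡ erase g ++ erase h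
erase-++ []         h = refl
erase-++ (la ∷ g)   h = cong (a ∷_) (erase-++ g h)
erase-++ (lb _ ∷ g) h = cong (b ∷_) (erase-++ g h)

height-snoc-la : ∀ {H} gl → #la gl ≡ H +ℕ #lb gl →
  #la (gl ++ [ la ]) ≡ suc H +ℕ #lb (gl ++ [ la ])
height-snoc-la gl ht rewrite erase-++ gl [ la ] = height-snoc-a (erase gl) ht

height-snoc-lb : ∀ {H i} gl → #la gl ≡ suc H +ℕ #lb gl →
  #la (gl ++ [ lb i ]) ≡ H +ℕ #lb (gl ++ [ lb i ])
height-snoc-lb {i = i} gl ht rewrite erase-++ gl [ lb i ] = height-snoc-b (erase gl) ht

LabelBelowHeight : List Lab → ℕ → Set
LabelBelowHeight p zero    = ⊤
LabelBelowHeight p (suc i) = + suc i ≤ℤ + #la p - + #lb p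

LabelBelowHeight⇔ : ∀ {H} p i → #la p ≡ H +ℕ #lb p → LabelBelowHeight p (suc i) ⇔ suc i ≤ H
LabelBelowHeight⇔ {H} p i ht =
  mk⇔ (ℤP.drop‿+≤+ ∘ subst (_ ≤ℤ_) height) (subst (_ ≤ℤ_) (sym height) ∘ +≤+)
  where
  height : + #la p - + #lb p ≡ + H
  height = trans (cong (λ m → + m - + #lb p) ht) (+[m+n]-+n≡+m H (#lb p))

AdmissibleLabel : List Lab → ℕ → Set
AdmissibleLabel p i = ((i ≡ 0) ⇔ (last p ≡ just la)) × LabelBelowHeight p i

AdmissibleLetter : List Lab → Lab → Set
AdmissibleLetter p la     = ⊤
AdmissibleLetter p (lb i) = AdmissibleLabel p i

AdmissibleAfter : List Lab → List Lab → Set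
AdmissibleAfter gl f = ∀ g i h → f ≡ g ++ lb i ∷ h → AdmissibleLabel (gl ++ g) i

AdmissibleAfter-[] : ∀ gl → AdmissibleAfter gl []
AdmissibleAfter-[] gl []      i h ()
AdmissibleAfter-[] gl (_ ∷ g) i h ()

AdmissibleAfter-∷⁺ : ∀ gl y {f} → AdmissibleLetter gl y → AdmissibleAfter (gl ++ [ y ]) f →
  AdmissibleAfter gl (y ∷ f)
AdmissibleAfter-∷⁺ gl (lb i) hd tl [] .i h refl =
  subst (λ p → AdmissibleLabel p i) (sym (++-identityʳ gl)) hd
AdmissibleAfter-∷⁺ gl y hd tl (.y ∷ g) i h refl =
  subst (λ p → AdmissibleLabel p i) (++-assoc gl [ y ] g) (tl g i h refl)

AdmissibleAfter-head : ∀ gl y {f} → AdmissibleAfter gl (y ∷ f) → AdmissibleLetter gl y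
AdmissibleAfter-head gl la     adm = tt
AdmissibleAfter-head gl (lb i) adm =
  subst (λ p → AdmissibleLabel p i) (++-identityʳ gl) (adm [] i _ refl)

AdmissibleAfter-tail : ∀ gl y {f} → AdmissibleAfter gl (y ∷ f) → AdmissibleAfter (gl ++ [ y ]) f
AdmissibleAfter-tail gl y adm g i h e =
  subst (λ p → AdmissibleLabel p i) (sym (++-assoc gl [ y ] g)) (adm (y ∷ g) i h (cong (y ∷_) e))

validFrom-b∷⁻ : ∀ {H t i f} → ValidFrom (suc H) t (lb i ∷ f) → ValidFrom H false f
validFrom-b∷⁻ (b₀∷ v)     = v
validFrom-b∷⁻ (b₁∷ v)     = v
validFrom-b∷⁻ (b₂₊∷ _ v)  = v

validFrom⇒admissibleLabel : ∀ {H t gl i f} → #la gl ≡ suc H +ℕ #lb gl → isLa (last gl) ≡ t →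
  ValidFrom (suc H) t (lb i ∷ f) → AdmissibleLabel gl i
validFrom⇒admissibleLabel ht lst (b₀∷ _) = mk⇔ (λ _ → isLa-true lst) (λ _ → refl) , tt
validFrom⇒admissibleLabel {gl = gl} ht lst (b₁∷ _) =
  mk⇔ (λ ()) (⊥-elim ∘ isLa-false lst) , Equivalence.from (LabelBelowHeight⇔ gl 0 ht) (s≤s z≤n)
validFrom⇒admissibleLabel {gl = gl} ht lst (b₂₊∷ {i = i} i<H _) =
  mk⇔ (λ ()) (⊥-elim ∘ isLa-false lst) , Equivalence.from (LabelBelowHeight⇔ gl (suc i) ht) (s≤s i<H)

validFrom⇒admissible : ∀ {H t gl f} → #la gl ≡ H +ℕ #lb gl → isLa (last gl) ≡ t →
  ValidFrom H t f → AdmissibleAfter gl f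
validFrom⇒admissible {gl = gl} {[]} ht lst v = AdmissibleAfter-[] gl
validFrom⇒admissible {gl = gl} {la ∷ f} ht lst (la∷ v) = AdmissibleAfter-∷⁺ gl la tt
  (validFrom⇒admissible (height-snoc-la gl ht) (cong isLa (last-snoc gl la)) v)
validFrom⇒admissible {zero} {f = lb i ∷ f} ht lst ()
validFrom⇒admissible {suc H} {gl = gl} {lb i ∷ f} ht lst v = AdmissibleAfter-∷⁺ gl (lb i)
  (validFrom⇒admissibleLabel ht lst v)
  (validFrom⇒admissible (height-snoc-lb gl ht) (cong isLa (last-snoc gl (lb i))) (validFrom-b∷⁻ v))

validFrom-b∷⁺ : ∀ {H t gl i f} → #la gl ≡ suc H +ℕ #lb gl → isLa (last gl) ≡ t →
  AdmissibleLabel gl i → ValidFrom H false f → ValidFrom (suc H) t (lb i ∷ f)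
validFrom-b∷⁺ {t = true} ht lst (label-0⇔after-a , _) v
  with Equivalence.from label-0⇔after-a (isLa-true lst)
... | refl = b₀∷ v
validFrom-b∷⁺ {t = false} {i = zero} ht lst (label-0⇔after-a , _) v =
  ⊥-elim (isLa-false lst (Equivalence.to label-0⇔after-a refl))
validFrom-b∷⁺ {t = false} {i = suc zero} ht lst _ v = b₁∷ v
validFrom-b∷⁺ {t = false} {gl} {suc (suc j)} ht lst (_ , below) v =
  b₂₊∷ (s≤s⁻¹ (Equivalence.to (LabelBelowHeight⇔ gl (suc j) ht) below)) v

admissible⇒validFrom : ∀ {H t gl} f → #la gl ≡ H +ℕ #lb gl → isLa (last gl) ≡ t →
  HeightBounded H (erase f) → AdmissibleAfter gl f → ValidFrom H t f
admissible⇒validFrom [] ht lst hb adm = []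
admissible⇒validFrom {gl = gl} (la ∷ f) ht lst hb adm =
  la∷ (admissible⇒validFrom f (height-snoc-la gl ht) (cong isLa (last-snoc gl la))
        (HeightBounded-a hb) (AdmissibleAfter-tail gl la adm))
admissible⇒validFrom {zero} (lb i ∷ f) ht lst hb adm = ⊥-elim (¬HeightBounded-0-b hb)
admissible⇒validFrom {suc H} {gl = gl} (lb i ∷ f) ht lst hb adm =
  validFrom-b∷⁺ ht lst (AdmissibleAfter-head gl (lb i) adm)
    (admissible⇒validFrom f (height-snoc-lb gl ht) (cong isLa (last-snoc gl (lb i)))
      (HeightBounded-b hb) (AdmissibleAfter-tail gl (lb i) adm))

isLabeling⇔validFrom : ∀ {w f} → Dyck w → IsLabeling w f ⇔ (ValidFrom 0 false f × erase f ≡ w)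
isLabeling⇔validFrom {w} {f} dyck = mk⇔ to from
  where
  to : IsLabeling w f → ValidFrom 0 false f × erase f ≡ w
  to (refl , zero⇔after-a , below) =
    admissible⇒validFrom f refl refl (Dyck⇒HeightBounded dyck) adm , refl
    where
    adm : AdmissibleAfter [] f
    adm g zero    h e = zero⇔after-a g zero h e , tt
    adm g (suc i) h e = zero⇔after-a g (suc i) h e , below g i h e
  from : ValidFrom 0 false f × erase f ≡ w → IsLabeling w f
  from (v , e) = e , (λ g i h e′ → proj₁ (adm g i h e′)) , (λ g i h e′ → proj₂ (adm g (suc i) h e′))
    where
    adm : AdmissibleAfter [] f
    adm = validFrom⇒admissible refl refl v

numLabelings : ∀ {w} → Dyck w → ∀ k → NumLabelings w k (#labelings 0 false w k)
numLabelings {w} dyck k =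
  labelings 0 false k w , labelings-unique 0 false k w , (λ f → mk⇔ sound complete) , refl
  where
  sound : ∀ {f} → f ∈ labelings 0 false k w → IsLabeling w f × #b₁ f ≡ k
  sound m with labelings-sound w m
  ... | v , e , c = Equivalence.from (isLabeling⇔validFrom dyck) (v , e) , c
  complete : ∀ {f} → IsLabeling w f × #b₁ f ≡ k → f ∈ labelings 0 false k w
  complete (isLab , refl) with Equivalence.to (isLabeling⇔validFrom dyck) isLab
  ... | v , refl = labelings-complete v

L≈shiftX-labelings : ∀ {w} → Dyck w → L w ≈ shiftX (#ab w) (yPoly (#labelings 0 false w))
L≈shiftX-labelings {w} dyck i j =
  trans (cong (λ F → F i j) (L≡L-after-[] w)) (L-after≈shiftX w refl refl (Dyck⇒HeightBounded dyck) i j)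

labelings-nonempty : ∀ {w} → Dyck w → ∃ λ k → #labelings 0 false w k ≢ 0
labelings-nonempty {w} dyck with validFrom-exists w false (Dyck⇒HeightBounded dyck)
... | f , v , refl = #b₁ f , nonempty (labelings-complete v)
  where
  nonempty : ∀ {fs : List (List Lab)} → f ∈ fs → length fs ≢ 0
  nonempty (here _) ()
  nonempty (there _) ()

proposition4 : (w : List AB) → Dyck w →
    (p : ℕ) (P : List ℤ) → L w ≈ (X^ p ⊛ ⟦ P ⟧y) → ¬ (X ∣₂ ⟦ P ⟧y) →
    (p ≡ #ab w)
    × (∀ (i : ℕ) → ∃ λ (n : ℕ) → NumLabelings w i n × coeff P i ≡ + n)
proposition4 w dyck p P L≈xᵖP X∤P with labelings-nonempty dyck
... | k , count≢0
  with shiftX-yPoly-unique P k count≢0 X∤P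
         (≈-trans (≈-sym (L≈shiftX-labelings dyck)) (≈-trans L≈xᵖP (X^⊛≈shiftX p ⟦ P ⟧y)))
...   | #ab≡p , coeff-P =
  sym #ab≡p , λ i → #labelings 0 false w i , numLabelings dyck i , coeff-P i
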